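{- Let $P$ be a poset on $\{1,\ldots,n\}$, let $C_r$ be a connected component of $G_P$ with vertex set $V(C_r)$, and let $J^{max}_r=\bigcup_{J'\in V(C_r)}J'$. Then: (1) $J^{max}_r$ is (a connected order ideal and) an isolated vertex of $G_P$. (2) If $J$ is a connected order ideal of $P$ such that $\chi_J$ is a subgraph of $C_r$ and $J\neq J^{max}_r$, then $J$ is a vertex of $C_r$.
   Context: An order ideal of $P$ is a subset $J$ with $i\in J$, $j\le_P i\Rightarrow j\in J$; a nonempty order ideal is connected if the Hasse diagram of $P$ restricted to it is connected. Sets $A,B$ intersect nontrivially if $A\cap B\ne\emptyset$, $A\not\subseteq B$, $B\not\subseteq A$. $G_P$ is the simple graph whose vertices are the connected order ideals of $P$, adjacent iff they intersect nontrivially. $\Lambda_i^P=\{k:k\le_P i\}$. $gs(J)$ is the set of $\le_P$-maximal elements of $J$; if $gs(J)=\{i_1,\ldots,i_k\}$, $\chi_J$ is the subgraph of $G_P$ induced by $\{\Lambda_{i_1}^P,\ldots,\Lambda_{i_k}^P\}$. -}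

module Defs where

open import Level using (0ℓ)
open import Data.Nat using (ℕ)
open import Data.Fin using (Fin)
open import Data.Fin.Subset using (Subset; _∈_; _∉_; _⊆_; Nonempty)
open import Data.Vec using (tabulate)
open import Data.Product using (Σ; _×_; ∃; ∃-syntax)
open import Data.Sum using (_⊎_)
open import Relation.Nullary using (¬_; does)
open import Relation.Binary using (Rel; IsDecPartialOrder)
open import Relation.Binary.PropositionalEquality using (_≡_)

-- A poset P on {1,…,n} is modelled as Fin n with a decidable partial order _≤P_.
module _ {n : ℕ} (_≤P_ : Rel (Fin n) 0ℓ) where

  _<P_ : Fin n → Fin n → Set
  i <P j = i ≤P j × ¬ (i ≡ j)

  Covers : Fin n → Fin n → Set
  Covers i j = i <P j × (∀ k → ¬ (i <P k × k <P j))

  IsOrderIdeal : Subset n → Set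
  IsOrderIdeal J = ∀ i j → i ∈ J → j ≤P i → j ∈ J

  data HassePath (J : Subset n) : Fin n → Fin n → Set where
    here : ∀ {i} → i ∈ J → HassePath J i i
    step : ∀ {i k j} → i ∈ J → (Covers i k ⊎ Covers k i) →
           HassePath J k j → HassePath J i j

  HasseConnected : Subset n → Set
  HasseConnected J = ∀ i j → i ∈ J → j ∈ J → HassePath J i j

  -- connected order ideal = vertex of G_P
  IsConnIdeal : Subset n → Set
  IsConnIdeal J = Nonempty J × IsOrderIdeal J × HasseConnected J

  NontrivInter : Subset n → Subset n → Set
  NontrivInter A B = (∃[ i ] (i ∈ A × i ∈ B)) × ¬ (A ⊆ B) × ¬ (B ⊆ A)

  Adj : Subset n → Subset n → Set
  Adj A B = IsConnIdeal A × IsConnIdeal B × NontrivInter A B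

  data InComp (J₀ : Subset n) : Subset n → Set where
    base : IsConnIdeal J₀ → InComp J₀ J₀
    next : ∀ {K L} → InComp J₀ K → Adj K L → InComp J₀ L

  IsIsolated : Subset n → Set
  IsIsolated J = IsConnIdeal J × (∀ K → IsConnIdeal K → ¬ Adj J K)

  IsMaximalIn : Subset n → Fin n → Set
  IsMaximalIn J i = i ∈ J × (∀ k → k ∈ J → i ≤P k → k ≡ i)

module _ {n : ℕ} {_≤P_ : Rel (Fin n) 0ℓ} where
  Λ : IsDecPartialOrder _≡_ _≤P_ → Fin n → Subset n
  Λ dpo i = tabulate (λ k → does (IsDecPartialOrder._≤?_ dpo k i))

module Submission where

open import Defs
open import Level using (0ℓ)
open import Data.Nat using (ℕ)
open import Data.Fin using (Fin; _≟_)
open import Data.Fin.Properties using (any?)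
open import Data.Fin.Induction using (po-noetherian)
open import Data.Fin.Subset using (Subset; _∈_; _⊆_)
open import Data.Fin.Subset.Properties using (_∈?_; _⊆?_; ⊆-trans; ⊆-antisym)
open import Data.Product using (_×_; _,_; proj₁; proj₂; ∃-syntax)
open import Data.Sum using (_⊎_; inj₁; inj₂)
open import Data.Empty using (⊥-elim)
open import Data.Vec.Properties using (lookup∘tabulate; []=⇒lookup; lookup⇒[]=)
open import Function.Base using (flip)
open import Function.Bundles using (_⇔_; module Equivalence)
open import Induction.WellFounded using (Acc; acc)
open import Relation.Nullary using (¬_; yes; no)
open import Relation.Nullary.Decidable using (dec-true; ¬?; _×-dec_)
open import Relation.Binary using (Rel; IsDecPartialOrder)
open import Relation.Binary.PropositionalEquality using (_≡_; sym; trans)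

-- Two connected order ideals that meet are either nested or adjacent in G_P.
-- Hence a connected ideal S containing one vertex of the component C contains
-- all of C unless S itself joins C: walking along an edge of C from a vertex
-- inside S, the neighbour meets S and cannot contain S. A neighbour K of J^max
-- meets some vertex of C, so it joins C or contains J^max, and both contradict
-- the nontrivial intersection. For J as in (2), Λ_m ⊆ J for a maximal m ∈ J, and
-- J ⊆ J^max because every element of J lies below a maximal one; so J joins C
-- or J = J^max.

open Equivalence using (to; from)

⊆⊎∃∉ : ∀ {n} (A B : Subset n) → A ⊆ B ⊎ ∃[ x ] (x ∈ A × ¬ x ∈ B)
⊆⊎∃∉ A B with any? (λ x → (x ∈? A) ×-dec ¬? (x ∈? B))
... | yes outside = inj₂ outside
... | no  none    = inj₁ λ {x} x∈A → inside x x∈A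
  where
  inside : ∀ x → x ∈ A → x ∈ B
  inside x x∈A with x ∈? B
  ... | yes x∈B = x∈B
  ... | no  x∉B = ⊥-elim (none (x , x∈A , x∉B))

module _ {n : ℕ} {_≤P_ : Rel (Fin n) 0ℓ} where

  HassePath-mono : ∀ {A B} → A ⊆ B → ∀ {i j} → HassePath _≤P_ A i j → HassePath _≤P_ B i j
  HassePath-mono A⊆B (here i∈A)        = here (A⊆B i∈A)
  HassePath-mono A⊆B (step i∈A c path) = step (A⊆B i∈A) c (HassePath-mono A⊆B path)

  HassePath-source : ∀ {A i j} → HassePath _≤P_ A i j → i ∈ A
  HassePath-source (here i∈A)     = i∈A
  HassePath-source (step i∈A _ _) = i∈A

  _++ᴴ_ : ∀ {A i j k} → HassePath _≤P_ A i j → HassePath _≤P_ A j k → HassePath _≤P_ A i k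
  here _       ++ᴴ q = q
  step i∈A c p ++ᴴ q = step i∈A c (p ++ᴴ q)

  HassePath-reverse : ∀ {A i j} → HassePath _≤P_ A i j → HassePath _≤P_ A j i
  HassePath-reverse (here i∈A) = here i∈A
  HassePath-reverse (step i∈A c p) =
    HassePath-reverse p ++ᴴ step (HassePath-source p) (flipCover c) (here i∈A)
    where
    flipCover : ∀ {a b} → Covers _≤P_ a b ⊎ Covers _≤P_ b a → Covers _≤P_ b a ⊎ Covers _≤P_ a b
    flipCover (inj₁ a⋖b) = inj₂ a⋖b
    flipCover (inj₂ b⋖a) = inj₁ b⋖a

  Adj-sym : ∀ {A B} → Adj _≤P_ A B → Adj _≤P_ B A
  Adj-sym (cA , cB , (i , i∈A , i∈B) , A⊈B , B⊈A) = cB , cA , (i , i∈B , i∈A) , B⊈A , A⊈B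

  meeting⇒nested⊎Adj : ∀ {A B i} → IsConnIdeal _≤P_ A → IsConnIdeal _≤P_ B → i ∈ A → i ∈ B →
                       A ⊆ B ⊎ B ⊆ A ⊎ Adj _≤P_ A B
  meeting⇒nested⊎Adj {A} {B} {i} cA cB i∈A i∈B with A ⊆? B | B ⊆? A
  ... | yes A⊆B | _       = inj₁ A⊆B
  ... | no _    | yes B⊆A = inj₂ (inj₁ B⊆A)
  ... | no A⊈B  | no B⊈A  = inj₂ (inj₂ (cA , cB , (i , i∈A , i∈B) , A⊈B , B⊈A))

  neighbour-⊆⊎Adj : ∀ {A B S} → IsConnIdeal _≤P_ S → Adj _≤P_ A B → A ⊆ S →
                    B ⊆ S ⊎ Adj _≤P_ B S
  neighbour-⊆⊎Adj cS (_ , cB , (i , i∈A , i∈B) , A⊈B , _) A⊆S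
    with meeting⇒nested⊎Adj cB cS i∈B (A⊆S i∈A)
  ... | inj₁ B⊆S        = inj₁ B⊆S
  ... | inj₂ (inj₁ S⊆B) = ⊥-elim (A⊈B (⊆-trans A⊆S S⊆B))
  ... | inj₂ (inj₂ adj) = inj₂ adj

  module Component (J₀ : Subset n) where

    InComp⇒IsConnIdeal : ∀ {K} → InComp _≤P_ J₀ K → IsConnIdeal _≤P_ K
    InComp⇒IsConnIdeal (base cJ₀)           = cJ₀
    InComp⇒IsConnIdeal (next _ (_ , cL , _)) = cL

    ⊇vertex⇒InComp⊎⊇vertex : ∀ {S L M} → IsConnIdeal _≤P_ S → InComp _≤P_ J₀ L → L ⊆ S →
                             InComp _≤P_ J₀ M → InComp _≤P_ J₀ S ⊎ M ⊆ S
    ⊇vertex⇒InComp⊎⊇vertex {S} cS L∈C L⊆S M∈C with ⊇root L∈C L⊆S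
      where
      ⊇root : ∀ {L} → InComp _≤P_ J₀ L → L ⊆ S → InComp _≤P_ J₀ S ⊎ J₀ ⊆ S
      ⊇root (base _) J₀⊆S = inj₂ J₀⊆S
      ⊇root (next K∈C adj) L⊆S with neighbour-⊆⊎Adj cS (Adj-sym adj) L⊆S
      ... | inj₁ K⊆S   = ⊇root K∈C K⊆S
      ... | inj₂ adjKS = inj₁ (next K∈C adjKS)
    ... | inj₁ S∈C  = inj₁ S∈C
    ... | inj₂ J₀⊆S = ⊇forward M∈C
      where
      ⊇forward : ∀ {M} → InComp _≤P_ J₀ M → InComp _≤P_ J₀ S ⊎ M ⊆ S
      ⊇forward (base _) = inj₂ J₀⊆S
      ⊇forward (next K∈C adj) with ⊇forward K∈C
      ... | inj₁ S∈C = inj₁ S∈C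
      ... | inj₂ K⊆S with neighbour-⊆⊎Adj cS adj K⊆S
      ...   | inj₁ M⊆S   = inj₂ M⊆S
      ...   | inj₂ adjMS = inj₁ (next (next K∈C adj) adjMS)

    module Union (Jmax : Subset n)
                 (Jmax-union : ∀ i → (i ∈ Jmax) ⇔ (∃[ K ] (InComp _≤P_ J₀ K × i ∈ K))) where

      InComp⇒⊆ : ∀ {K} → InComp _≤P_ J₀ K → K ⊆ Jmax
      InComp⇒⊆ {K} K∈C {x} x∈K = from (Jmax-union x) (K , K∈C , x∈K)

      ⊇vertex⇒InComp⊎⊇Jmax : ∀ {S L} → IsConnIdeal _≤P_ S → InComp _≤P_ J₀ L → L ⊆ S →
                             InComp _≤P_ J₀ S ⊎ Jmax ⊆ S
      ⊇vertex⇒InComp⊎⊇Jmax {S} cS L∈C L⊆S with ⊆⊎∃∉ Jmax S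
      ... | inj₁ Jmax⊆S = inj₂ Jmax⊆S
      ... | inj₂ (x , x∈Jmax , x∉S) with to (Jmax-union x) x∈Jmax
      ...   | M , M∈C , x∈M with ⊇vertex⇒InComp⊎⊇vertex cS L∈C L⊆S M∈C
      ...     | inj₁ S∈C = inj₁ S∈C
      ...     | inj₂ M⊆S = ⊥-elim (x∉S (M⊆S x∈M))

      Jmax-isConnIdeal : IsConnIdeal _≤P_ J₀ → IsConnIdeal _≤P_ Jmax
      Jmax-isConnIdeal cJ₀@((x₀ , x₀∈J₀) , _) =
        (x₀ , InComp⇒⊆ (base cJ₀) x₀∈J₀) , isOrderIdeal , isConnected
        where
        path-in-vertex : ∀ {K i j} → InComp _≤P_ J₀ K → i ∈ K → j ∈ K → HassePath _≤P_ Jmax i j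
        path-in-vertex K∈C i∈K j∈K =
          HassePath-mono (InComp⇒⊆ K∈C) (proj₂ (proj₂ (InComp⇒IsConnIdeal K∈C)) _ _ i∈K j∈K)

        path-from-x₀ : ∀ {K j} → InComp _≤P_ J₀ K → j ∈ K → HassePath _≤P_ Jmax x₀ j
        path-from-x₀ K∈C@(base _) j∈K = path-in-vertex K∈C x₀∈J₀ j∈K
        path-from-x₀ L∈C@(next K∈C (_ , _ , (c , c∈K , c∈L) , _)) j∈L =
          path-from-x₀ K∈C c∈K ++ᴴ path-in-vertex L∈C c∈L j∈L

        isOrderIdeal : IsOrderIdeal _≤P_ Jmax
        isOrderIdeal i j i∈Jmax j≤i with to (Jmax-union i) i∈Jmax
        ... | K , K∈C , i∈K =
          InComp⇒⊆ K∈C (proj₁ (proj₂ (InComp⇒IsConnIdeal K∈C)) i j i∈K j≤i)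

        isConnected : HasseConnected _≤P_ Jmax
        isConnected i j i∈Jmax j∈Jmax with to (Jmax-union i) i∈Jmax | to (Jmax-union j) j∈Jmax
        ... | K , K∈C , i∈K | L , L∈C , j∈L =
          HassePath-reverse (path-from-x₀ K∈C i∈K) ++ᴴ path-from-x₀ L∈C j∈L

      Jmax-isolated : ∀ K → IsConnIdeal _≤P_ K → ¬ Adj _≤P_ Jmax K
      Jmax-isolated K cK (_ , _ , (i , i∈Jmax , i∈K) , Jmax⊈K , K⊈Jmax) with to (Jmax-union i) i∈Jmax
      ... | L , L∈C , i∈L with meeting⇒nested⊎Adj (InComp⇒IsConnIdeal L∈C) cK i∈L i∈K
      ...   | inj₂ (inj₁ K⊆L) = K⊈Jmax (⊆-trans K⊆L (InComp⇒⊆ L∈C))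
      ...   | inj₂ (inj₂ adj) = K⊈Jmax (InComp⇒⊆ (next L∈C adj))
      ...   | inj₁ L⊆K with ⊇vertex⇒InComp⊎⊇Jmax cK L∈C L⊆K
      ...     | inj₁ K∈C    = K⊈Jmax (InComp⇒⊆ K∈C)
      ...     | inj₂ Jmax⊆K = Jmax⊈K Jmax⊆K

module _ {n : ℕ} {_≤P_ : Rel (Fin n) 0ℓ} (po : IsDecPartialOrder _≡_ _≤P_) where

  open IsDecPartialOrder po using (_≤?_; isPartialOrder) renaming (trans to ≤-trans)

  ≤⇒∈Λ : ∀ {x m} → x ≤P m → x ∈ Λ po m
  ≤⇒∈Λ {x} {m} x≤m =
    lookup⇒[]= x (Λ po m) (trans (lookup∘tabulate _ x) (dec-true (x ≤? m) x≤m))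

  ∈Λ⇒≤ : ∀ {x m} → x ∈ Λ po m → x ≤P m
  ∈Λ⇒≤ {x} {m} x∈Λ with x ≤? m | trans (sym ([]=⇒lookup x∈Λ)) (lookup∘tabulate _ x)
  ... | yes x≤m | _ = x≤m
  ... | no  _   | ()

  maximal-above : ∀ {J j} → j ∈ J → ∃[ m ] (IsMaximalIn _≤P_ J m × j ≤P m)
  maximal-above {J} {j} j∈J = climb (po-noetherian isPartialOrder j) j∈J
    where
    climb : ∀ {j} → Acc (flip (_<P_ _≤P_)) j → j ∈ J → ∃[ m ] (IsMaximalIn _≤P_ J m × j ≤P m)
    climb {j} (acc higher) j∈J with any? (λ k → (k ∈? J) ×-dec ((j ≤? k) ×-dec ¬? (j ≟ k)))
    ... | yes (k , k∈J , j<k) with climb (higher j<k) k∈J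
    ...   | m , m-max , k≤m = m , m-max , ≤-trans (proj₁ j<k) k≤m
    climb {j} _ j∈J | no none = j , (j∈J , j-max) , IsDecPartialOrder.refl po
      where
      j-max : ∀ k → k ∈ J → j ≤P k → k ≡ j
      j-max k k∈J j≤k with k ≟ j
      ... | yes k≡j = k≡j
      ... | no  k≢j = ⊥-elim (none (k , k∈J , j≤k , λ j≡k → k≢j (sym j≡k)))

  module _ {J₀ Jmax : Subset n}
           (Jmax-union : ∀ i → (i ∈ Jmax) ⇔ (∃[ K ] (InComp _≤P_ J₀ K × i ∈ K))) where

    open Component {_≤P_ = _≤P_} J₀
    open Union Jmax Jmax-union

    generators-InComp⇒InComp : ∀ {J} → IsConnIdeal _≤P_ J →
                                  (∀ i → IsMaximalIn _≤P_ J i → InComp _≤P_ J₀ (Λ po i)) →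
                                  ¬ J ≡ Jmax → InComp _≤P_ J₀ J
    generators-InComp⇒InComp {J} cJ@((j , j∈J) , isIdeal , _) Λ∈C J≢Jmax
      with maximal-above j∈J
    ... | m , m-max@(m∈J , _) , _ with ⊇vertex⇒InComp⊎⊇Jmax cJ (Λ∈C m m-max) Λm⊆J
      where
      Λm⊆J : Λ po m ⊆ J
      Λm⊆J x∈Λm = isIdeal m _ m∈J (∈Λ⇒≤ x∈Λm)
    ...   | inj₁ J∈C    = J∈C
    ...   | inj₂ Jmax⊆J = ⊥-elim (J≢Jmax (⊆-antisym J⊆Jmax Jmax⊆J))
      where
      J⊆Jmax : J ⊆ Jmax
      J⊆Jmax x∈J with maximal-above x∈J
      ... | k , k-max , x≤k = InComp⇒⊆ (Λ∈C k k-max) (≤⇒∈Λ x≤k)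

lemma3p4 : (n : ℕ) (_≤P_ : Rel (Fin n) 0ℓ) (po : IsDecPartialOrder _≡_ _≤P_)
    → (J₀ : Subset n) → IsConnIdeal _≤P_ J₀
    → (Jmax : Subset n)
    → (∀ i → (i ∈ Jmax) ⇔ (∃[ K ] (InComp _≤P_ J₀ K × i ∈ K)))
    → IsIsolated _≤P_ Jmax
      × (∀ J → IsConnIdeal _≤P_ J
           → (∀ i → IsMaximalIn _≤P_ J i → InComp _≤P_ J₀ (Λ po i))
           → ¬ (J ≡ Jmax)
           → InComp _≤P_ J₀ J)
lemma3p4 n _≤P_ po J₀ cJ₀ Jmax Jmax-union =
  (Jmax-isConnIdeal cJ₀ , Jmax-isolated) , λ J cJ → generators-InComp⇒InComp po Jmax-union cJ
  where open Component {_≤P_ = _≤P_} J₀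
        open Union Jmax Jmax-union
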